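{- Every instance $\varphi$ of an axiom schema of $\mathbf{vD}$ is valid: for every topological model $\langle\langle X,\tau\rangle,v\rangle$ for $\mathbf{vD}$, $v(\varphi)=X$.
   Context: $\mathcal{L}$ is the set of formulas over a denumerable set of variables $V$ with binary connectives $\land,\lor,\longrightarrow$ and unary $\neg,\circ$. Fix a formula $\beta_0$, set $\bot:=\beta_0\land(\neg\beta_0\land\circ\beta_0)$ and $\sim\alpha:=\alpha\longrightarrow\bot$. The axiom schemas of $\mathbf{vD}$ are (for all $\alpha,\beta,\gamma$, with $\to$ denoting $\longrightarrow$): (1) $\alpha\to(\beta\to\alpha)$; (2) $(\alpha\to(\beta\to\gamma))\to((\alpha\to\beta)\to(\alpha\to\gamma))$; (3) $\alpha\to(\beta\to(\alpha\land\beta))$; (4) $(\alpha\land\beta)\to\alpha$; (5) $(\alpha\land\beta)\to\beta$; (6) $\alpha\to(\alpha\lor\beta)$; (7) $\beta\to(\alpha\lor\beta)$; (8) $(\alpha\to\beta)\lor\alpha$; (9) $\alpha\lor\neg\alpha$; (10) $(\alpha\to\gamma)\to((\neg\alpha\to\gamma)\to((\alpha\lor\neg\alpha)\to\gamma))$; (11) $((\alpha\to\beta)\to\gamma)\to((\alpha\to\gamma)\to(((\alpha\to\beta)\lor\alpha)\to\gamma))$; (12) $\circ\alpha\to(\alpha\to(\neg\alpha\to\beta))$; (13) $\circ\alpha\lor(\alpha\land\neg\alpha)$; (14) $(\circ\alpha\to\gamma)\to(((\alpha\land\neg\alpha)\to\gamma)\to((\circ\alpha\lor(\alpha\land\neg\alpha))\to\gamma))$;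 (15) $\sim\neg\alpha\to\sim\neg\sim\neg\alpha$; (16) $\sim\neg\sim\neg\alpha\to\sim\neg\alpha$; (17) $\sim\neg(\alpha\land\beta)\to(\sim\neg\alpha\land\sim\neg\beta)$; (18) $(\sim\neg\alpha\land\sim\neg\beta)\to\sim\neg(\alpha\land\beta)$. A topological model for $\mathbf{vD}$ is a pair $\langle\langle X,\tau\rangle,v\rangle$ where $\langle X,\tau\rangle$ is a topological space and $v:\mathcal{L}\to\mathcal{P}(X)$ satisfies, for all $\alpha,\beta$: $v(\alpha\longrightarrow\beta)=v(\alpha)^c\cup v(\beta)$; $v(\neg\alpha)=\overline{v(\alpha)^c}$; $v(\sim\alpha)=v(\alpha)^c$; $v(\alpha\land\beta)=v(\alpha)\cap v(\beta)$; $v(\alpha)\cup v(\beta)\subseteq v(\alpha\lor\beta)$; $v(\circ\alpha)=v(\alpha)^c\cup\mathrm{Int}(v(\alpha))$ ($^c$ = complement in $X$, overline = closure). -}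

module Defs where

open import Level using (0ℓ)
open import Data.Nat using (ℕ)
open import Data.Product using (_×_; _,_; ∃)
open import Relation.Unary using (Pred; _⊆_; _∈_; ∁; _∪_; _∩_; ∅; U; _≐_)

infixr 6 _∧ₗ_
infixr 5 _∨ₗ_
infixr 4 _⟶_

data Form : Set where
  var  : ℕ → Form
  _∧ₗ_ : Form → Form → Form
  _∨ₗ_ : Form → Form → Form
  _⟶_  : Form → Form → Form
  ¬ₗ_  : Form → Form
  ∘ₗ_  : Form → Form

⊥[_] : Form → Form
⊥[ β₀ ] = β₀ ∧ₗ ((¬ₗ β₀) ∧ₗ (∘ₗ β₀))

∼[_]_ : Form → Form → Form
∼[ β₀ ] α = α ⟶ ⊥[ β₀ ]

data Axiom (β₀ : Form) : Form → Set where
  ax1  : ∀ α β → Axiom β₀ (α ⟶ (β ⟶ α))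
  ax2  : ∀ α β γ → Axiom β₀ ((α ⟶ (β ⟶ γ)) ⟶ ((α ⟶ β) ⟶ (α ⟶ γ)))
  ax3  : ∀ α β → Axiom β₀ (α ⟶ (β ⟶ (α ∧ₗ β)))
  ax4  : ∀ α β → Axiom β₀ ((α ∧ₗ β) ⟶ α)
  ax5  : ∀ α β → Axiom β₀ ((α ∧ₗ β) ⟶ β)
  ax6  : ∀ α β → Axiom β₀ (α ⟶ (α ∨ₗ β))
  ax7  : ∀ α β → Axiom β₀ (β ⟶ (α ∨ₗ β))
  ax8  : ∀ α β → Axiom β₀ ((α ⟶ β) ∨ₗ α)
  ax9  : ∀ α → Axiom β₀ (α ∨ₗ (¬ₗ α))
  ax10 : ∀ α γ → Axiom β₀ ((α ⟶ γ) ⟶ (((¬ₗ α) ⟶ γ) ⟶ ((α ∨ₗ (¬ₗ α)) ⟶ γ)))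
  ax11 : ∀ α β γ → Axiom β₀ (((α ⟶ β) ⟶ γ) ⟶ ((α ⟶ γ) ⟶ (((α ⟶ β) ∨ₗ α) ⟶ γ)))
  ax12 : ∀ α β → Axiom β₀ ((∘ₗ α) ⟶ (α ⟶ ((¬ₗ α) ⟶ β)))
  ax13 : ∀ α → Axiom β₀ ((∘ₗ α) ∨ₗ (α ∧ₗ (¬ₗ α)))
  ax14 : ∀ α γ → Axiom β₀ (((∘ₗ α) ⟶ γ) ⟶ (((α ∧ₗ (¬ₗ α)) ⟶ γ) ⟶ (((∘ₗ α) ∨ₗ (α ∧ₗ (¬ₗ α))) ⟶ γ)))
  ax15 : ∀ α → Axiom β₀ ((∼[ β₀ ] (¬ₗ α)) ⟶ (∼[ β₀ ] (¬ₗ (∼[ β₀ ] (¬ₗ α)))))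
  ax16 : ∀ α → Axiom β₀ ((∼[ β₀ ] (¬ₗ (∼[ β₀ ] (¬ₗ α)))) ⟶ (∼[ β₀ ] (¬ₗ α)))
  ax17 : ∀ α β → Axiom β₀ ((∼[ β₀ ] (¬ₗ (α ∧ₗ β))) ⟶ ((∼[ β₀ ] (¬ₗ α)) ∧ₗ (∼[ β₀ ] (¬ₗ β))))
  ax18 : ∀ α β → Axiom β₀ (((∼[ β₀ ] (¬ₗ α)) ∧ₗ (∼[ β₀ ] (¬ₗ β))) ⟶ (∼[ β₀ ] (¬ₗ (α ∧ₗ β))))

-- A topology τ on X is presented as a family of
-- subsets O : I → Pred X indexed by a set I (τ = {O i | i ∈ I}),
-- containing ∅ and X and closed under binary intersections and
-- arbitrary unions (unions of arbitrary subfamilies S ⊆ I).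

record Topology (X : Set) : Set₁ where
  field
    I          : Set
    O          : I → Pred X 0ℓ
    ∅-open     : ∃ λ i → O i ≐ ∅
    X-open     : ∃ λ i → O i ≐ U
    ∩-open     : ∀ i j → ∃ λ k → O k ≐ (O i ∩ O j)
    ⋃-open     : (S : Pred I 0ℓ) → ∃ λ k → O k ≐ (λ x → ∃ λ i → S i × O i x)

module _ {X : Set} (τ : Topology X) where
  open Topology τ

  Int : Pred X 0ℓ → Pred X 0ℓ
  Int A x = ∃ λ i → (O i ⊆ A) × O i x

  Cl : Pred X 0ℓ → Pred X 0ℓ
  Cl A x = ∀ i → O i x → ∃ λ y → O i y × A y

record TopModel (β₀ : Form) : Set₁ where
  field
    X   : Set
    τ   : Topology X
    v   : Form → Pred X 0ℓ
    v-⟶ : ∀ α β → v (α ⟶ β) ≐ (∁ (v α) ∪ v β)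
    v-¬ : ∀ α → v (¬ₗ α) ≐ Cl τ (∁ (v α))
    v-∼ : ∀ α → v (∼[ β₀ ] α) ≐ ∁ (v α)
    v-∧ : ∀ α β → v (α ∧ₗ β) ≐ (v α ∩ v β)
    v-∨ : ∀ α β → (v α ∪ v β) ⊆ v (α ∨ₗ β)
    v-∘ : ∀ α → v (∘ₗ α) ≐ (∁ (v α) ∪ Int τ (v α))

{-# OPTIONS --safe #-}
module Submission where

open import Defs
open import Level using (0ℓ)
open import Relation.Unary using (Pred; U; _≐_; _⊆_; _∈_; _∉_; ∁; _∪_; _∩_; Universal)
open import Axiom.ExcludedMiddle using (ExcludedMiddle)
open import Axiom.DoubleNegationElimination using (em⇒dne)
open import Data.Product using (_,_; proj₁; proj₂)
open import Data.Sum using (inj₁; inj₂; [_,_])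
open import Data.Empty using (⊥-elim)
open import Data.Unit using (tt)
open import Relation.Nullary using (yes; no)

-- In a topological model ∼¬α denotes the interior of α, so schemas (15)–(18)
-- are the interior axioms Int A = Int (Int A) and Int (A ∩ B) = Int A ∩ Int B.
-- Since ⟶ and ∼ are classical, the remaining schemas hold pointwise by the
-- classical truth tables, given that X = v α ∪ v ¬α, X = v α ∪ v (α ⟶ β) and
-- X = v ∘α ∪ v (α ∧ ¬α), while v ∘α ∩ v α ∩ v ¬α = ∅; the last two because
-- the complement of v ∘α is v α ∖ Int (v α) = v α ∩ Cl (∁ (v α)).

module _ {X : Set} (τ : Topology X) where
  open Topology τ

  Int-deflationary : {A : Pred X 0ℓ} → Int τ A ⊆ A
  Int-deflationary (i , Oi⊆A , x∈Oi) = Oi⊆A x∈Oi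

  Int-idempotent : {A : Pred X 0ℓ} → Int τ A ⊆ Int τ (Int τ A)
  Int-idempotent (i , Oi⊆A , x∈Oi) = i , (λ y∈Oi → i , Oi⊆A , y∈Oi) , x∈Oi

  Int-mono : {A B : Pred X 0ℓ} → A ⊆ B → Int τ A ⊆ Int τ B
  Int-mono A⊆B (i , Oi⊆A , x∈Oi) = i , (λ y∈Oi → A⊆B (Oi⊆A y∈Oi)) , x∈Oi

  Int-∩ : {A B : Pred X 0ℓ} → (Int τ A ∩ Int τ B) ⊆ Int τ (A ∩ B)
  Int-∩ ((i , Oi⊆A , x∈Oi) , (j , Oj⊆B , x∈Oj)) with ∩-open i j
  ... | k , Ok⊆Oi∩Oj , Oi∩Oj⊆Ok =
    k , (λ y∈Ok → let y∈Oi , y∈Oj = Ok⊆Oi∩Oj y∈Ok in Oi⊆A y∈Oi , Oj⊆B y∈Oj)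
      , Oi∩Oj⊆Ok (x∈Oi , x∈Oj)

  ⊆-Cl : {A : Pred X 0ℓ} → A ⊆ Cl τ A
  ⊆-Cl {x = x} x∈A i x∈Oi = x , x∈Oi , x∈A

  Int⊆∁Cl∁ : {A : Pred X 0ℓ} → Int τ A ⊆ ∁ (Cl τ (∁ A))
  Int⊆∁Cl∁ (i , Oi⊆A , x∈Oi) x∈Cl with x∈Cl i x∈Oi
  ... | y , y∈Oi , y∉A = y∉A (Oi⊆A y∈Oi)

  ∁Cl∁⊆Int : ExcludedMiddle 0ℓ → {A : Pred X 0ℓ} → ∁ (Cl τ (∁ A)) ⊆ Int τ A
  ∁Cl∁⊆Int em {A} x∉Cl = dne λ x∉Int → x∉Cl λ i x∈Oi →
    dne λ Oi⊆A → x∉Int (i , (λ {y} y∈Oi → dne λ y∉A → Oi⊆A (y , y∈Oi , y∉A)) , x∈Oi)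
    where dne = em⇒dne em

module Validity (em : ExcludedMiddle 0ℓ) {β₀ : Form} (M : TopModel β₀) where
  open TopModel M

  ⟶-intro : ∀ {α β x} → (x ∈ v α → x ∈ v β) → x ∈ v (α ⟶ β)
  ⟶-intro {α} {β} {x} f with em {v α x}
  ... | yes x∈α = proj₂ (v-⟶ α β) (inj₂ (f x∈α))
  ... | no x∉α = proj₂ (v-⟶ α β) (inj₁ x∉α)

  ⟶-elim : ∀ {α β x} → x ∈ v (α ⟶ β) → x ∈ v α → x ∈ v β
  ⟶-elim {α} {β} x∈α⟶β x∈α with proj₁ (v-⟶ α β) x∈α⟶β
  ... | inj₁ x∉α = ⊥-elim (x∉α x∈α)
  ... | inj₂ x∈β = x∈β

  ⊆⇒valid-⟶ : ∀ {α β} → v α ⊆ v β → Π[ v (α ⟶ β) ]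
  ⊆⇒valid-⟶ α⊆β _ = ⟶-intro α⊆β

  v-∼¬ : ∀ α → v (∼[ β₀ ] (¬ₗ α)) ≐ Int τ (v α)
  v-∼¬ α = (λ x∈∼¬α → ∁Cl∁⊆Int τ em λ x∈Cl → proj₁ (v-∼ (¬ₗ α)) x∈∼¬α (proj₂ (v-¬ α) x∈Cl))
         , (λ x∈Int → proj₂ (v-∼ (¬ₗ α)) λ x∈¬α → Int⊆∁Cl∁ τ x∈Int (proj₁ (v-¬ α) x∈¬α))

  valid-∨ : ∀ {α β} → Π[ v α ∪ v β ] → Π[ v (α ∨ₗ β) ]
  valid-∨ {α} {β} cover x = v-∨ α β (cover x)

  valid-cases : ∀ {α β γ} → Π[ v α ∪ v β ] →
    Π[ v ((α ⟶ γ) ⟶ ((β ⟶ γ) ⟶ ((α ∨ₗ β) ⟶ γ))) ]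
  valid-cases cover x = ⟶-intro λ α⟶γ → ⟶-intro λ β⟶γ → ⟶-intro λ _ →
    [ ⟶-elim α⟶γ , ⟶-elim β⟶γ ] (cover x)

  v-∼¬-idempotent : ∀ α → v (∼[ β₀ ] (¬ₗ α)) ≐ v (∼[ β₀ ] (¬ₗ (∼[ β₀ ] (¬ₗ α))))
  v-∼¬-idempotent α =
      (λ p → proj₂ (v-∼¬ ∼¬α) (Int-mono τ (proj₂ (v-∼¬ α)) (Int-idempotent τ (proj₁ (v-∼¬ α) p))))
    , (λ p → proj₂ (v-∼¬ α) (Int-deflationary τ (Int-mono τ (proj₁ (v-∼¬ α)) (proj₁ (v-∼¬ ∼¬α) p))))
    where ∼¬α = ∼[ β₀ ] (¬ₗ α)

  v-∼¬-∧ : ∀ α β → v (∼[ β₀ ] (¬ₗ (α ∧ₗ β))) ≐ v ((∼[ β₀ ] (¬ₗ α)) ∧ₗ (∼[ β₀ ] (¬ₗ β)))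
  v-∼¬-∧ α β =
      (λ p → let q = proj₁ (v-∼¬ (α ∧ₗ β)) p in proj₂ (v-∧ _ _)
        ( proj₂ (v-∼¬ α) (Int-mono τ (λ r → proj₁ (proj₁ (v-∧ α β) r)) q)
        , proj₂ (v-∼¬ β) (Int-mono τ (λ r → proj₂ (proj₁ (v-∧ α β) r)) q)))
    , (λ p → let p₁ , p₂ = proj₁ (v-∧ _ _) p in proj₂ (v-∼¬ (α ∧ₗ β))
        (Int-mono τ (proj₂ (v-∧ α β)) (Int-∩ τ (proj₁ (v-∼¬ α) p₁ , proj₁ (v-∼¬ β) p₂))))

  ∘-consistent : ∀ {α x} → x ∈ v (∘ₗ α) → x ∈ v α → x ∉ v (¬ₗ α)
  ∘-consistent {α} x∈∘α x∈α x∈¬α with proj₁ (v-∘ α) x∈∘α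
  ... | inj₁ x∉α = x∉α x∈α
  ... | inj₂ x∈Int = Int⊆∁Cl∁ τ x∈Int (proj₁ (v-¬ α) x∈¬α)

  ∁∘⊆∧¬ : ∀ α → ∁ (v (∘ₗ α)) ⊆ v (α ∧ₗ (¬ₗ α))
  ∁∘⊆∧¬ α x∉∘α = proj₂ (v-∧ α (¬ₗ α))
    ( dne (λ x∉α → x∉∘α (proj₂ (v-∘ α) (inj₁ x∉α)))
    , proj₂ (v-¬ α) (dne λ x∉Cl → x∉∘α (proj₂ (v-∘ α) (inj₂ (∁Cl∁⊆Int τ em x∉Cl)))))
    where dne = em⇒dne em

  covers-⟶ : ∀ α β → Π[ v (α ⟶ β) ∪ v α ]
  covers-⟶ α β x with em {v α x}
  ... | yes x∈α = inj₂ x∈α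
  ... | no x∉α = inj₁ (⟶-intro λ x∈α → ⊥-elim (x∉α x∈α))

  covers-¬ : ∀ α → Π[ v α ∪ v (¬ₗ α) ]
  covers-¬ α x with em {v α x}
  ... | yes x∈α = inj₁ x∈α
  ... | no x∉α = inj₂ (proj₂ (v-¬ α) (⊆-Cl τ x∉α))

  covers-∘ : ∀ α → Π[ v (∘ₗ α) ∪ v (α ∧ₗ (¬ₗ α)) ]
  covers-∘ α x with em {v (∘ₗ α) x}
  ... | yes x∈∘α = inj₁ x∈∘α
  ... | no x∉∘α = inj₂ (∁∘⊆∧¬ α x∉∘α)

  valid : ∀ {φ} → Axiom β₀ φ → Π[ v φ ]
  valid (ax1 α β) _ = ⟶-intro λ a → ⟶-intro λ _ → a
  valid (ax2 α β γ) _ = ⟶-intro λ f → ⟶-intro λ g → ⟶-intro λ a → ⟶-elim (⟶-elim f a) (⟶-elim g a)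
  valid (ax3 α β) _ = ⟶-intro λ a → ⟶-intro λ b → proj₂ (v-∧ α β) (a , b)
  valid (ax4 α β) = ⊆⇒valid-⟶ λ p → proj₁ (proj₁ (v-∧ α β) p)
  valid (ax5 α β) = ⊆⇒valid-⟶ λ p → proj₂ (proj₁ (v-∧ α β) p)
  valid (ax6 α β) = ⊆⇒valid-⟶ λ a → v-∨ α β (inj₁ a)
  valid (ax7 α β) = ⊆⇒valid-⟶ λ b → v-∨ α β (inj₂ b)
  valid (ax8 α β) = valid-∨ (covers-⟶ α β)
  valid (ax9 α) = valid-∨ (covers-¬ α)
  valid (ax10 α γ) = valid-cases (covers-¬ α)
  valid (ax11 α β γ) = valid-cases (covers-⟶ α β)
  valid (ax12 α β) _ = ⟶-intro λ o → ⟶-intro λ a → ⟶-intro λ n → ⊥-elim (∘-consistent o a n)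
  valid (ax13 α) = valid-∨ (covers-∘ α)
  valid (ax14 α γ) = valid-cases (covers-∘ α)
  valid (ax15 α) = ⊆⇒valid-⟶ (proj₁ (v-∼¬-idempotent α))
  valid (ax16 α) = ⊆⇒valid-⟶ (proj₂ (v-∼¬-idempotent α))
  valid (ax17 α β) = ⊆⇒valid-⟶ (proj₁ (v-∼¬-∧ α β))
  valid (ax18 α β) = ⊆⇒valid-⟶ (proj₂ (v-∼¬-∧ α β))

lemma4p2 : ExcludedMiddle 0ℓ →
    (β₀ φ : Form) → Axiom β₀ φ →
    (M : TopModel β₀) → TopModel.v M φ ≐ U
lemma4p2 em β₀ φ ax M = (λ _ → tt) , λ {x} _ → Validity.valid em M ax x
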